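{- Let $k\ge2$ and let $F(x)\in\mathbb{Q}[[x]]$ be a $k$-Mahler function. Let $S(\Delta_k)=q_0(x)+q_1(x)\Delta_k+\cdots+q_s(x)\Delta_k^s$ be a nonzero annihilator of $F$ of minimal degree in $\Delta_k$, normalized so that $q_i(x)\in\mathbb{Q}[x]$, $\gcd(q_0,\dots,q_s)=1$, and $q_0(x)q_s(x)\neq0$. Suppose that $$R(\Delta_k)=\frac{a_0(x)}{b_0(x)}+\frac{a_1(x)}{b_1(x)}\Delta_k+\cdots+\frac{a_r(x)}{b_r(x)}\Delta_k^r,$$ with $a_i(x),b_i(x)\in\mathbb{Q}[x]$, $\gcd(a_i,b_i)=1$, is such that $R(\Delta_k)S(\Delta_k)\in\mathbb{Q}[x][\Delta_k]$ is an annihilator of $F$ of degree $s+r$. Then $b_r(x)$ divides $q_0(x)q_0(x^k)\cdots q_0(x^{k^{r-1}})$.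
   Context: $\Delta_k:\mathbb{Q}[[x]]\to\mathbb{Q}[[x]]$ is $\Delta_k(G(x))=G(x^k)$. $\mathbb{Q}(x)[\Delta_k]$ is the skew polynomial ring of operators $\sum_i c_i(x)\Delta_k^i$ with $c_i\in\mathbb{Q}(x)$, multiplied by composition, so $\Delta_k\, c(x)=c(x^k)\,\Delta_k$. An element annihilates $F$ if it sends $F$ to $0$. $F$ is $k$-Mahler if it has a nonzero annihilator in $\mathbb{Q}(x)[\Delta_k]$; the degree of an operator is its degree in $\Delta_k$. -}

module Defs where

open import Data.Nat using (ℕ; zero; suc; _∸_; _^_; _≤_; _<_; _%_; _/_)
open import Data.Nat as ℕ using ()
open import Data.Rational using (ℚ; 0ℚ; 1ℚ) renaming (_+_ to _+q_; _*_ to _*q_)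
open import Data.List using (List; []; _∷_; map; replicate; _++_; foldr; upTo; length)
open import Data.Product using (_×_; _,_; proj₁; proj₂; ∃)
open import Relation.Binary.PropositionalEquality using (_≡_)
open import Relation.Nullary using (¬_)
open import Data.Bool using (if_then_else_)

PS : Set
PS = ℕ → ℚ

zeroPS : PS
zeroPS _ = 0ℚ

_⊕_ : PS → PS → PS
(F ⊕ G) n = F n +q G n

_≐_ : PS → PS → Set
F ≐ G = ∀ n → F n ≡ G n

shift : PS → PS
shift H zero    = 0ℚ
shift H (suc n) = H n

-- Δ_m on power series: G(x) ↦ G(x^m) (only used with m = k^i ≥ 1;
-- m = 0 is a dummy case).
substPS : ℕ → PS → PS
substPS zero    F n = 0ℚ
substPS (suc m) F n = if ℕ._≡ᵇ_ (n % suc m) 0 then F (n / suc m) else 0ℚ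

-- Polynomials Q[x]: coefficient lists, lowest degree first
-- (trailing zeros allowed; equality is coefficientwise).

Poly : Set
Poly = List ℚ

coeff : Poly → PS
coeff []      n       = 0ℚ
coeff (a ∷ p) zero    = a
coeff (a ∷ p) (suc n) = coeff p n

_≈ₚ_ : Poly → Poly → Set
p ≈ₚ q = coeff p ≐ coeff q

NonZeroP : Poly → Set
NonZeroP p = ¬ (p ≈ₚ [])

oneP : Poly
oneP = 1ℚ ∷ []

addP : Poly → Poly → Poly
addP []      q       = q
addP (a ∷ p) []      = a ∷ p
addP (a ∷ p) (b ∷ q) = (a +q b) ∷ addP p q

scaleP : ℚ → Poly → Poly
scaleP c p = map (c *q_) p

mulP : Poly → Poly → Poly
mulP []      q = []
mulP (a ∷ p) q = addP (scaleP a q) (0ℚ ∷ mulP p q)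

prodP : List Poly → Poly
prodP = foldr mulP oneP

-- p(x) ↦ p(x^m), for m ≥ 1.
substP : ℕ → Poly → Poly
substP m []      = []
substP m (a ∷ p) = a ∷ (replicate (m ∸ 1) 0ℚ ++ substP m p)

_∣ₚ_ : Poly → Poly → Set
p ∣ₚ q = ∃ λ d → mulP d p ≈ₚ q

CoprimeFamily : ℕ → (ℕ → Poly) → Set
CoprimeFamily s q = ∀ d → (∀ i → i ≤ s → d ∣ₚ q i) → d ∣ₚ oneP

Coprime2 : Poly → Poly → Set
Coprime2 a b = ∀ d → d ∣ₚ a → d ∣ₚ b → d ∣ₚ oneP

_·ₚ_ : Poly → PS → PS
([]      ·ₚ G) n = 0ℚ
((a ∷ p) ·ₚ G) n = (a *q G n) +q shift (p ·ₚ G) n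

-- Rational functions Q(x): (numerator , denominator)

RatFun : Set
RatFun = Poly × Poly

ValidRF : RatFun → Set
ValidRF (a , b) = NonZeroP b

ZeroRF : RatFun → Set
ZeroRF (a , b) = a ≈ₚ []

rf0 : RatFun
rf0 = ([] , oneP)

rfAdd : RatFun → RatFun → RatFun
rfAdd (a , b) (c , d) = (addP (mulP a d) (mulP c b) , mulP b d)

rfMul : RatFun → RatFun → RatFun
rfMul (a , b) (c , d) = (mulP a c , mulP b d)

rfSubst : ℕ → RatFun → RatFun
rfSubst m (a , b) = (substP m a , substP m b)

IsPolyRF : RatFun → Set
IsPolyRF (a , b) = ∃ λ p → a ≈ₚ mulP p b

-- Operators in Q(x)[Δ_k]: list of coefficients c_0, c_1, ... of Δ_k^i.

ROp : Set
ROp = List RatFun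

data AllL {A : Set} (P : A → Set) : List A → Set where
  all[]  : AllL P []
  all∷ : ∀ {x xs} → P x → AllL P xs → AllL P (x ∷ xs)

data AnyL {A : Set} (P : A → Set) : List A → Set where
  here  : ∀ {x xs} → P x → AnyL P (x ∷ xs)
  there : ∀ {x xs} → AnyL P xs → AnyL P (x ∷ xs)

ValidOp : ROp → Set
ValidOp = AllL ValidRF

NonZeroOp : ROp → Set
NonZeroOp = AnyL (λ c → ¬ ZeroRF c)

coeffAt : ROp → ℕ → RatFun
coeffAt []      n       = rf0
coeffAt (c ∷ L) zero    = c
coeffAt (c ∷ L) (suc n) = coeffAt L n

HasDegree : ROp → ℕ → Set
HasDegree L d = ¬ ZeroRF (coeffAt L d) × (∀ j → d < j → ZeroRF (coeffAt L j))

-- Applying Σ_{j} (a_j/b_j) Δ_k^{i+j} (the tail of an operator starting at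
-- index i) to F, written as N / D with N ∈ Q[[x]], D ∈ Q[x] the product of
-- the denominators.
applyCleared : ℕ → ℕ → ROp → PS → PS × Poly
applyCleared k i []            F = (zeroPS , oneP)
applyCleared k i ((a , b) ∷ L) F =
  let ND = applyCleared k (suc i) L F
      N  = proj₁ ND
      D  = proj₂ ND
  in  (((mulP a D) ·ₚ substPS (k ^ i) F) ⊕ (b ·ₚ N)) , mulP b D

-- L annihilates F (equality L(F) = 0 in Q((x)), multiplied through by the
-- nonzero product of denominators)
Annihilates : ℕ → ROp → PS → Set
Annihilates k L F = proj₁ (applyCleared k 0 L F) ≐ zeroPS

IsMahler : ℕ → PS → Set
IsMahler k F = ∃ λ L → ValidOp L × NonZeroOp L × Annihilates k L F

-- composition product in Q(x)[Δ_k]: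
-- (Σ c_i Δ^i)(Σ d_j Δ^j) = Σ_m (Σ_{i+j=m} c_i(x) d_j(x^{k^i})) Δ^m
opMul : ℕ → ROp → ROp → ROp
opMul k L M = map coef (upTo (length L ℕ.+ length M ∸ 1))
  where
  coef : ℕ → RatFun
  coef m = foldr rfAdd rf0
             (map (λ i → rfMul (coeffAt L i) (rfSubst (k ^ i) (coeffAt M (m ∸ i))))
                  (upTo (suc m)))

polyOp : ℕ → (ℕ → Poly) → ROp
polyOp s q = map (λ i → (q i , oneP)) (upTo (suc s))

ratOp : ℕ → (ℕ → Poly) → (ℕ → Poly) → ROp
ratOp r a b = map (λ i → (a i , b i)) (upTo (suc r))

-- Clear the denominators of R with B = b₀ b₁ ⋯ b_r and put αᵢ = aᵢ B / bᵢ. As R S has polynomial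
-- coefficients, B divides every cleared coefficient c_m = Σ_{i ≤ m} αᵢ q_{m-i}(x^{k^i}). Multiplying c_t by
-- Q_t = q₀(x) q₀(x^k) ⋯ q₀(x^{k^{t-1}}) disposes of the terms i < t once B ∣ αᵢ Q_{i+1} is known for them,
-- so induction gives B ∣ α_t Q_{t+1}; the same elimination applied to c_{r+j}, whose terms beyond i = r
-- vanish, gives B ∣ α_r q_j(x^{k^r}) Q_r for every j ≤ s. Cancelling B / b_r leaves b_r ∣ a_r q_j(x^{k^r}) Q_r,
-- and the Bézout identities behind the two coprimality hypotheses (the second one transported by x ↦ x^{k^r})
-- remove first a_r and then the q_j(x^{k^r}).

module Submission where

open import Defs
open import Algebra.Bundles using (Monoid; CommutativeMonoid; AbelianGroup; CommutativeRing)
open import Data.Bool.Base using (if_then_else_)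
open import Data.Empty using (⊥-elim)
open import Data.List.Base using ([]; _∷_; map; replicate; _++_; length; foldr; applyUpTo; upTo)
open import Data.List.Properties using (length-map; length-upTo)
open import Data.Maybe.Base using (Maybe; just; nothing)
open import Data.Nat.Base as Nat using (ℕ; zero; suc; _∸_; _^_; _≤_; _<_; _≡ᵇ_; z≤n; s≤s; z<s; s<s)
open import Data.Nat.Induction using (<-rec)
open import Data.Nat.Properties as Nat
  using (≤-refl; ≤-trans; ≤-pred; <⇒≤; ≰⇒>; _≤?_; n∸n≡0; m+n∸m≡n; m≤m+n; +-monoʳ-≤; m+[n∸m]≡n; m+n≤o⇒m≤o∸n)
open import Data.Product.Base using (Σ-syntax; ∃; ∃₂; _×_; _,_; proj₁; proj₂)
open import Data.Sum.Base using (_⊎_; inj₁; inj₂)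
open import Function.Base using (_∘_; id)
open import Level using (0ℓ)
open import Relation.Binary.PropositionalEquality.Core using (_≡_; _≢_; cong; cong₂; subst)
open import Relation.Binary.PropositionalEquality.Properties using (module ≡-Reasoning)
open import Relation.Binary.Structures using (IsEquivalence)
open import Relation.Nullary using (¬_; yes; no)
import Relation.Binary.Reasoning.Setoid
import Tactic.RingSolver.Core.AlmostCommutativeRing as ACR
open import Tactic.RingSolver using (solve-∀)

module BigOperator {c ℓ} (M : Monoid c ℓ) where

  open Monoid M
  open import Data.Nat.Base using (_+_)

  ⨁< : ℕ → (ℕ → Carrier) → Carrier
  ⨁< zero    f = ε
  ⨁< (suc n) f = f 0 ∙ ⨁< n (f ∘ suc)

  ⨁<-cong : ∀ n {f g} → (∀ i → i < n → f i ≈ g i) → ⨁< n f ≈ ⨁< n g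
  ⨁<-cong zero    f≈g = refl
  ⨁<-cong (suc n) f≈g = ∙-cong (f≈g 0 z<s) (⨁<-cong n (λ i i<n → f≈g (suc i) (s<s i<n)))

  ⨁<-identity : ∀ n {f} → (∀ i → i < n → f i ≈ ε) → ⨁< n f ≈ ε
  ⨁<-identity zero    f≈ε = refl
  ⨁<-identity (suc n) f≈ε =
    trans (∙-cong (f≈ε 0 z<s) (⨁<-identity n (λ i i<n → f≈ε (suc i) (s<s i<n)))) (identityˡ ε)

  ⨁<-+ : ∀ m n f → ⨁< (m + n) f ≈ ⨁< m f ∙ ⨁< n (λ i → f (m + i))
  ⨁<-+ zero    n f = sym (identityˡ _)
  ⨁<-+ (suc m) n f = trans (∙-congˡ (⨁<-+ m n (f ∘ suc))) (sym (assoc _ _ _))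

  ⨁<-suc : ∀ n f → ⨁< (suc n) f ≈ ⨁< n f ∙ f n
  ⨁<-suc zero    f = trans (identityʳ (f 0)) (sym (identityˡ (f 0)))
  ⨁<-suc (suc n) f = trans (∙-congˡ (⨁<-suc n (f ∘ suc))) (sym (assoc _ _ _))

module CommutativeRingProperties {c ℓ} (R : CommutativeRing c ℓ) where

  open CommutativeRing R
  open import Algebra.Properties.Semiring.Divisibility semiring public
  open import Relation.Binary.Reasoning.Setoid setoid
  open import Algebra.Properties.CommutativeSemigroup *-commutativeSemigroup using (x∙yz≈y∙xz; xy∙z≈xz∙y; xy∙z≈x∙zy; interchange)

  open BigOperator +-monoid public using ()
    renaming (⨁< to ∑<; ⨁<-cong to ∑<-cong; ⨁<-identity to ∑<-zero; ⨁<-+ to ∑<-+; ⨁<-suc to ∑<-suc)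
  open BigOperator *-monoid public using ()
    renaming (⨁< to ∏<; ⨁<-+ to ∏<-+; ⨁<-suc to ∏<-suc)

  *-distribʳ-∑< : ∀ n f x → ∑< n f * x ≈ ∑< n (λ i → f i * x)
  *-distribʳ-∑< zero    f x = zeroˡ x
  *-distribʳ-∑< (suc n) f x = trans (distribʳ x (f 0) _) (+-congˡ (*-distribʳ-∑< n (f ∘ suc) x))

  *-distribˡ-∑< : ∀ n x f → x * ∑< n f ≈ ∑< n (λ i → x * f i)
  *-distribˡ-∑< zero    x f = zeroʳ x
  *-distribˡ-∑< (suc n) x f = trans (distribˡ x (f 0) _) (+-congˡ (*-distribˡ-∑< n x (f ∘ suc)))

  ∑<-factorˡ : ∀ n x (w q : ℕ → Carrier) → ∑< n (λ j → x * w j * q j) ≈ x * ∑< n (λ j → w j * q j)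
  ∑<-factorˡ n x w q = trans (∑<-cong n (λ j _ → *-assoc x (w j) (q j))) (sym (*-distribˡ-∑< n x (λ j → w j * q j)))

  ∣-+ : ∀ {d x y} → d ∣ x → d ∣ y → d ∣ x + y
  ∣-+ {d} (p , pd≈x) (q , qd≈y) = p + q , trans (distribʳ d p q) (+-cong pd≈x qd≈y)

  ∣-+-cancelˡ : ∀ {d x y} → d ∣ x + y → d ∣ x → d ∣ y
  ∣-+-cancelˡ {d} {x} {y} (p , pd≈x+y) (q , qd≈x) = p - q , (begin
    (p - q) * d    ≈⟨ [y-z]x≈yx-zx d p q ⟩
    p * d - q * d  ≈⟨ +-cong pd≈x+y (-‿cong qd≈x) ⟩
    x + y - x      ≈⟨ xyx⁻¹≈y x y ⟩
    y              ∎)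
    where
    open import Algebra.Properties.Ring ring using ([y-z]x≈yx-zx)
    open import Algebra.Properties.AbelianGroup +-abelianGroup using (xyx⁻¹≈y)

  ∣-∑< : ∀ n {d f} → (∀ i → i < n → d ∣ f i) → d ∣ ∑< n f
  ∣-∑< zero    d∣f = _∣0 _
  ∣-∑< (suc n) d∣f = ∣-+ (d∣f 0 z<s) (∣-∑< n (λ i i<n → d∣f (suc i) (s<s i<n)))

  ∏<-∣ : ∀ {m n} f → m ≤ n → ∏< m f ∣ ∏< n f
  ∏<-∣ {m} {n} f m≤n = ∏< (n ∸ m) (λ i → f (m Nat.+ i)) , (begin
    ∏< (n ∸ m) (λ i → f (m Nat.+ i)) * ∏< m f   ≈⟨ *-comm _ _ ⟩
    ∏< m f * ∏< (n ∸ m) (λ i → f (m Nat.+ i))   ≈⟨ sym (∏<-+ m (n ∸ m) f) ⟩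
    ∏< (m Nat.+ (n ∸ m)) f                      ≡⟨ cong (λ k → ∏< k f) (m+[n∸m]≡n m≤n) ⟩
    ∏< n f                                      ∎)

  cofactor : ℕ → (ℕ → Carrier) → ℕ → Carrier
  cofactor n d i = ∏< n (λ t → if t ≡ᵇ i then 1# else d t)

  *-cofactor : ∀ n d {i} → i < n → d i * cofactor n d i ≈ ∏< n d
  *-cofactor (suc n) d {zero}  _         = *-congˡ (*-identityˡ _)
  *-cofactor (suc n) d {suc i} (s<s i<n) = begin
    d (suc i) * (d 0 * cofactor n (d ∘ suc) i)  ≈⟨ x∙yz≈y∙xz (d (suc i)) (d 0) _ ⟩
    d 0 * (d (suc i) * cofactor n (d ∘ suc) i)  ≈⟨ *-congˡ (*-cofactor n (d ∘ suc) i<n) ⟩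
    d 0 * ∏< n (d ∘ suc)                        ∎

  bezout⇒∣ : ∀ u v {a b x} → u * a + v * b ≈ 1# → b ∣ a * x → b ∣ x
  bezout⇒∣ u v {a} {b} {x} ua+vb≈1 b∣ax = ∣ʳ-respʳ-≈ x≈ (∣-+ (x∣ʳy⇒x∣ʳzy u b∣ax) (x∣ʳyx b (v * x)))
    where
    x≈ : u * (a * x) + v * x * b ≈ x
    x≈ = begin
      u * (a * x) + v * x * b  ≈⟨ +-cong (sym (*-assoc u a x)) (xy∙z≈xz∙y v x b) ⟩
      u * a * x + v * b * x    ≈⟨ sym (distribʳ x (u * a) (v * b)) ⟩
      (u * a + v * b) * x      ≈⟨ *-congʳ ua+vb≈1 ⟩
      1# * x                   ≈⟨ *-identityˡ x ⟩
      x                        ∎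

  ∑-bezout⇒∣ : ∀ n {w q : ℕ → Carrier} {d x} → ∑< n (λ j → w j * q j) ≈ 1# → (∀ j → j < n → d ∣ q j * x) → d ∣ x
  ∑-bezout⇒∣ n {w} {q} {d} {x} ∑wq≈1 d∣qx = ∣ʳ-respʳ-≈ x≈ (∣-∑< n (λ j j<n → x∣ʳy⇒x∣ʳzy (w j) (d∣qx j j<n)))
    where
    x≈ : ∑< n (λ j → w j * (q j * x)) ≈ x
    x≈ = begin
      ∑< n (λ j → w j * (q j * x))  ≈⟨ ∑<-cong n (λ j _ → sym (*-assoc (w j) (q j) x)) ⟩
      ∑< n (λ j → w j * q j * x)    ≈⟨ sym (*-distribʳ-∑< n (λ j → w j * q j) x) ⟩
      ∑< n (λ j → w j * q j) * x    ≈⟨ *-congʳ ∑wq≈1 ⟩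
      1# * x                        ≈⟨ *-identityˡ x ⟩
      x                             ∎

  -- For α i = aᵢ B / bᵢ and β i j = q_j(x^{k^i}), conv m is B times the coefficient of Δ^m in R S
  -- and Q n = q₀(x) q₀(x^k) ⋯ q₀(x^{k^{n-1}}).
  module Elimination (B : Carrier) (α : ℕ → Carrier) (β : ℕ → ℕ → Carrier) where

    Q : ℕ → Carrier
    Q n = ∏< n (λ u → β u 0)

    conv : ℕ → Carrier
    conv m = ∑< (suc m) (λ i → α i * β i (m ∸ i))

    leading-∣ : ∀ t {y : ℕ → Carrier} {z} → (∀ i → i < t → B ∣ α i * Q (suc i)) →
                B ∣ ∑< t (λ i → α i * y i) + α t * z → B ∣ α t * z * Q t
    leading-∣ t {y} {z} B∣αQ B∣sum = ∣-+-cancelˡ B∣whole B∣lower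
      where
      term : ∀ i → i < t → B ∣ α i * y i * Q t
      term i i<t with ∏<-∣ (λ u → β u 0) i<t
      ... | c , cQ≈Q = ∣ʳ-respʳ-≈ (trans (interchange (y i) c (α i) _) (*-cong (*-comm (y i) (α i)) cQ≈Q))
                                  (x∣ʳy⇒x∣ʳzy (y i * c) (B∣αQ i i<t))
      B∣lower : B ∣ ∑< t (λ i → α i * y i) * Q t
      B∣lower = ∣ʳ-respʳ-≈ (sym (*-distribʳ-∑< t _ (Q t))) (∣-∑< t term)
      B∣whole : B ∣ ∑< t (λ i → α i * y i) * Q t + α t * z * Q t
      B∣whole = ∣ʳ-respʳ-≈ (trans (*-comm (Q t) _) (distribʳ (Q t) _ _)) (x∣ʳy⇒x∣ʳzy (Q t) B∣sum)

    ∣-α*Q : ∀ n → (∀ m → m ≤ n → B ∣ conv m) → ∀ t → t ≤ n → B ∣ α t * Q (suc t)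
    ∣-α*Q n B∣conv = <-rec (λ t → t ≤ n → B ∣ α t * Q (suc t)) step
      where
      step : ∀ t → (∀ {i} → i < t → i ≤ n → B ∣ α i * Q (suc i)) → t ≤ n → B ∣ α t * Q (suc t)
      step t rec t≤n = ∣ʳ-respʳ-≈ αβQ≈αQ
        (leading-∣ t (λ i i<t → rec i<t (≤-trans (<⇒≤ i<t) t≤n)) (∣ʳ-respʳ-≈ conv-split (B∣conv t t≤n)))
        where
        conv-split : conv t ≈ ∑< t (λ i → α i * β i (t ∸ i)) + α t * β t 0
        conv-split = trans (∑<-suc t _) (+-congˡ (reflexive (cong (λ j → α t * β t j) (n∸n≡0 t))))
        αβQ≈αQ : α t * β t 0 * Q t ≈ α t * Q (suc t)
        αβQ≈αQ = trans (xy∙z≈x∙zy (α t) (β t 0) (Q t)) (*-congˡ (sym (∏<-suc t (λ u → β u 0))))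

    ∣-α*β*Q : ∀ r s → (∀ i → r < i → α i ≈ 0#) → (∀ m → m ≤ r Nat.+ s → B ∣ conv m) →
              ∀ j → j ≤ s → B ∣ α r * β r j * Q r
    ∣-α*β*Q r s α≈0 B∣conv j j≤s =
      leading-∣ r (λ i i<r → ∣-α*Q (r Nat.+ s) B∣conv i (≤-trans (<⇒≤ i<r) (m≤m+n r s)))
                  (∣ʳ-respʳ-≈ conv-split (B∣conv (r Nat.+ j) (+-monoʳ-≤ r j≤s)))
      where
      f : ℕ → Carrier
      f i = α i * β i (r Nat.+ j ∸ i)
      conv-split : conv (r Nat.+ j) ≈ ∑< r f + α r * β r j
      conv-split = begin
        ∑< (suc r Nat.+ j) f                            ≈⟨ ∑<-+ (suc r) j f ⟩
        ∑< (suc r) f + ∑< j (λ i → f (suc r Nat.+ i))   ≈⟨ +-congˡ (∑<-zero j (λ i _ → f≈0 (suc r Nat.+ i) (s≤s (m≤m+n r i)))) ⟩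
        ∑< (suc r) f + 0#                               ≈⟨ +-identityʳ _ ⟩
        ∑< (suc r) f                                    ≈⟨ ∑<-suc r f ⟩
        ∑< r f + f r                                    ≡⟨ cong (λ k → ∑< r f + α r * β r k) (m+n∸m≡n r j) ⟩
        ∑< r f + α r * β r j                            ∎
        where
        f≈0 : ∀ i → r < i → f i ≈ 0#
        f≈0 i r<i = trans (*-congʳ (α≈0 i r<i)) (zeroˡ _)

module Polynomial where

  open import Relation.Binary.PropositionalEquality.Core using (refl; sym; trans)
  open import Data.Rational.Base using (ℚ; 0ℚ; 1ℚ; _+_; _*_; -_; 1/_; ≢-nonZero)
  open import Data.Rational.Properties
    using (+-identityˡ; +-identityʳ; +-comm; +-assoc; +-inverseʳ; *-identityˡ; *-identityʳ; *-zeroˡ; *-zeroʳ; *-comm;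
           *-assoc; *-distribˡ-+; *-inverseˡ; *-inverseʳ; 1≢0; _≟_; +-0-commutativeMonoid)

  infix 4 _≈_

  -- A record rather than a synonym for _≈ₚ_, so that both polynomials can be inferred from an equation.
  record _≈_ (p q : Poly) : Set where
    constructor coeffwise
    field at : p ≈ₚ q
  open _≈_ public

  ≈-refl : ∀ {p} → p ≈ p
  ≈-refl = coeffwise λ _ → refl

  ≈-sym : ∀ {p q} → p ≈ q → q ≈ p
  ≈-sym p≈q = coeffwise λ n → sym (at p≈q n)

  ≈-trans : ∀ {p q r} → p ≈ q → q ≈ r → p ≈ r
  ≈-trans p≈q q≈r = coeffwise λ n → trans (at p≈q n) (at q≈r n)

  negP : Poly → Poly
  negP = map -_

  coeff-addP : ∀ p q n → coeff (addP p q) n ≡ coeff p n + coeff q n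
  coeff-addP []      q       n       = sym (+-identityˡ _)
  coeff-addP (a ∷ p) []      n       = sym (+-identityʳ _)
  coeff-addP (a ∷ p) (b ∷ q) zero    = refl
  coeff-addP (a ∷ p) (b ∷ q) (suc n) = coeff-addP p q n

  coeff-scaleP : ∀ c p n → coeff (scaleP c p) n ≡ c * coeff p n
  coeff-scaleP c []      n       = sym (*-zeroʳ c)
  coeff-scaleP c (a ∷ p) zero    = refl
  coeff-scaleP c (a ∷ p) (suc n) = coeff-scaleP c p n

  coeff-negP : ∀ p n → coeff (negP p) n ≡ - coeff p n
  coeff-negP []      n       = refl
  coeff-negP (a ∷ p) zero    = refl
  coeff-negP (a ∷ p) (suc n) = coeff-negP p n

  coeff-0∷ : ∀ p n → coeff (0ℚ ∷ p) n ≡ shift (coeff p) n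
  coeff-0∷ p zero    = refl
  coeff-0∷ p (suc n) = refl

  coeff-mulP : ∀ a p q n → coeff (mulP (a ∷ p) q) n ≡ a * coeff q n + shift (coeff (mulP p q)) n
  coeff-mulP a p q n = trans (coeff-addP (scaleP a q) (0ℚ ∷ mulP p q) n) (cong₂ _+_ (coeff-scaleP a q n) (coeff-0∷ (mulP p q) n))

  ∷-cong : ∀ {a b p q} → a ≡ b → p ≈ q → a ∷ p ≈ b ∷ q
  ∷-cong a≡b p≈q = coeffwise λ { zero → a≡b ; (suc n) → at p≈q n }

  ∷-injective : ∀ {a b p q} → a ∷ p ≈ b ∷ q → (a ≡ b) × (p ≈ q)
  ∷-injective e = at e 0 , coeffwise λ n → at e (suc n)

  0∷[]≈[] : 0ℚ ∷ [] ≈ []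
  0∷[]≈[] = coeffwise λ { zero → refl ; (suc n) → refl }

  addP-cong : ∀ {p p′ q q′} → p ≈ p′ → q ≈ q′ → addP p q ≈ addP p′ q′
  addP-cong {p} {p′} {q} {q′} p≈p′ q≈q′ = coeffwise λ n →
    trans (coeff-addP p q n) (trans (cong₂ _+_ (at p≈p′ n) (at q≈q′ n)) (sym (coeff-addP p′ q′ n)))

  negP-cong : ∀ {p q} → p ≈ q → negP p ≈ negP q
  negP-cong {p} {q} p≈q = coeffwise λ n →
    trans (coeff-negP p n) (trans (cong -_ (at p≈q n)) (sym (coeff-negP q n)))

  addP-comm : ∀ p q → addP p q ≈ addP q p
  addP-comm p q = coeffwise λ n →
    trans (coeff-addP p q n) (trans (+-comm (coeff p n) _) (sym (coeff-addP q p n)))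

  addP-assoc : ∀ p q r → addP (addP p q) r ≈ addP p (addP q r)
  addP-assoc p q r = coeffwise λ n → begin
    coeff (addP (addP p q) r) n               ≡⟨ trans (coeff-addP (addP p q) r n) (cong (_+ coeff r n) (coeff-addP p q n)) ⟩
    coeff p n + coeff q n + coeff r n         ≡⟨ +-assoc (coeff p n) _ _ ⟩
    coeff p n + (coeff q n + coeff r n)       ≡⟨ sym (trans (coeff-addP p (addP q r) n) (cong (coeff p n +_) (coeff-addP q r n))) ⟩
    coeff (addP p (addP q r)) n               ∎
    where open ≡-Reasoning

  addP-identityʳ : ∀ p → addP p [] ≈ p
  addP-identityʳ p = coeffwise λ n → trans (coeff-addP p [] n) (+-identityʳ _)

  addP-inverseʳ : ∀ p → addP p (negP p) ≈ []
  addP-inverseʳ p = coeffwise λ n →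
    trans (coeff-addP p (negP p) n) (trans (cong (coeff p n +_) (coeff-negP p n)) (+-inverseʳ (coeff p n)))

  scaleP-cong : ∀ c {p q} → p ≈ q → scaleP c p ≈ scaleP c q
  scaleP-cong c {p} {q} p≈q = coeffwise λ n →
    trans (coeff-scaleP c p n) (trans (cong (c *_) (at p≈q n)) (sym (coeff-scaleP c q n)))

  mulP-congʳ : ∀ p {q q′} → q ≈ q′ → mulP p q ≈ mulP p q′
  mulP-congʳ []      q≈q′ = ≈-refl
  mulP-congʳ (a ∷ p) q≈q′ = addP-cong (scaleP-cong a q≈q′) (∷-cong refl (mulP-congʳ p q≈q′))

  mulP-zeroʳ : ∀ p → mulP p [] ≈ []
  mulP-zeroʳ []      = ≈-refl
  mulP-zeroʳ (a ∷ p) = ≈-trans (∷-cong refl (mulP-zeroʳ p)) 0∷[]≈[]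

  mulP-0∷ : ∀ p q → mulP (0ℚ ∷ p) q ≈ 0ℚ ∷ mulP p q
  mulP-0∷ p q = coeffwise λ n →
    trans (coeff-mulP 0ℚ p q n) (trans (cong (_+ shift (coeff (mulP p q)) n) (*-zeroˡ (coeff q n)))
      (trans (+-identityˡ _) (sym (coeff-0∷ (mulP p q) n))))

  mulP-∷ʳ : ∀ p b q → mulP p (b ∷ q) ≈ addP (scaleP b p) (0ℚ ∷ mulP p q)
  mulP-∷ʳ []      b q = coeffwise λ { zero → refl ; (suc n) → refl }
  mulP-∷ʳ (a ∷ p) b q = coeffwise λ
    { zero    → trans (coeff-mulP a p (b ∷ q) 0) (cong (_+ 0ℚ) (*-comm a b))
    ; (suc n) → begin
        coeff (mulP (a ∷ p) (b ∷ q)) (suc n)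
          ≡⟨ coeff-mulP a p (b ∷ q) (suc n) ⟩
        a * coeff q n + coeff (mulP p (b ∷ q)) n
          ≡⟨ cong (a * coeff q n +_) (trans (at (mulP-∷ʳ p b q) n) (trans (coeff-addP (scaleP b p) (0ℚ ∷ mulP p q) n)
                                            (cong₂ _+_ (coeff-scaleP b p n) (coeff-0∷ (mulP p q) n)))) ⟩
        a * coeff q n + (b * coeff p n + shift (coeff (mulP p q)) n)
          ≡⟨ x∙yz≈y∙xz (a * coeff q n) (b * coeff p n) _ ⟩
        b * coeff p n + (a * coeff q n + shift (coeff (mulP p q)) n)
          ≡⟨ sym (trans (coeff-addP (scaleP b p) (mulP (a ∷ p) q) n) (cong₂ _+_ (coeff-scaleP b p n) (coeff-mulP a p q n))) ⟩
        coeff (addP (scaleP b p) (mulP (a ∷ p) q)) n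
          ∎
    }
    where
    open ≡-Reasoning
    open import Algebra.Properties.CommutativeSemigroup (CommutativeMonoid.commutativeSemigroup +-0-commutativeMonoid)
      using (x∙yz≈y∙xz)

  ≈-isEquivalence : IsEquivalence _≈_
  ≈-isEquivalence = record { refl = ≈-refl ; sym = ≈-sym ; trans = ≈-trans }

  addP-abelianGroup : AbelianGroup 0ℓ 0ℓ
  addP-abelianGroup = record
    { Carrier = Poly ; _≈_ = _≈_ ; _∙_ = addP ; ε = [] ; _⁻¹ = negP
    ; isAbelianGroup = record
      { isGroup = record
        { isMonoid = record
          { isSemigroup = record
            { isMagma = record { isEquivalence = ≈-isEquivalence ; ∙-cong = addP-cong }
            ; assoc = addP-assoc }
          ; identity = (λ p → ≈-refl) , addP-identityʳ }
        ; inverse = (λ p → ≈-trans (addP-comm (negP p) p) (addP-inverseʳ p)) , addP-inverseʳ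
        ; ⁻¹-cong = negP-cong }
      ; comm = addP-comm } }

  open import Algebra.Properties.CommutativeSemigroup
    (AbelianGroup.commutativeSemigroup addP-abelianGroup) using (interchange)
  module ≈-Reasoning = Relation.Binary.Reasoning.Setoid (AbelianGroup.setoid addP-abelianGroup)

  scaleP-addP : ∀ c p q → scaleP c (addP p q) ≈ addP (scaleP c p) (scaleP c q)
  scaleP-addP c p q = coeffwise λ n → begin
    coeff (scaleP c (addP p q)) n                ≡⟨ trans (coeff-scaleP c (addP p q) n) (cong (c *_) (coeff-addP p q n)) ⟩
    c * (coeff p n + coeff q n)                  ≡⟨ *-distribˡ-+ c (coeff p n) (coeff q n) ⟩
    c * coeff p n + c * coeff q n                ≡⟨ sym (trans (coeff-addP (scaleP c p) (scaleP c q) n)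
                                                               (cong₂ _+_ (coeff-scaleP c p n) (coeff-scaleP c q n))) ⟩
    coeff (addP (scaleP c p) (scaleP c q)) n     ∎
    where open ≡-Reasoning

  scaleP-scaleP : ∀ c d p → scaleP (c * d) p ≈ scaleP c (scaleP d p)
  scaleP-scaleP c d p = coeffwise λ n → trans (coeff-scaleP (c * d) p n)
    (trans (*-assoc c d (coeff p n)) (sym (trans (coeff-scaleP c (scaleP d p) n) (cong (c *_) (coeff-scaleP d p n)))))

  scaleP-identity : ∀ p → scaleP 1ℚ p ≈ p
  scaleP-identity p = coeffwise λ n → trans (coeff-scaleP 1ℚ p n) (*-identityˡ (coeff p n))

  mulP-comm : ∀ p q → mulP p q ≈ mulP q p
  mulP-comm []      q = ≈-sym (mulP-zeroʳ q)
  mulP-comm (a ∷ p) q = ≈-trans (addP-cong ≈-refl (∷-cong refl (mulP-comm p q))) (≈-sym (mulP-∷ʳ q a p))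

  mulP-distribˡ : ∀ p q r → mulP p (addP q r) ≈ addP (mulP p q) (mulP p r)
  mulP-distribˡ []      q r = ≈-refl
  mulP-distribˡ (a ∷ p) q r = begin
    addP (scaleP a (addP q r)) (0ℚ ∷ mulP p (addP q r))
      ≈⟨ addP-cong (scaleP-addP a q r) (∷-cong (sym (+-identityˡ 0ℚ)) (mulP-distribˡ p q r)) ⟩
    addP (addP (scaleP a q) (scaleP a r)) (addP (0ℚ ∷ mulP p q) (0ℚ ∷ mulP p r))
      ≈⟨ interchange (scaleP a q) (scaleP a r) _ _ ⟩
    addP (mulP (a ∷ p) q) (mulP (a ∷ p) r)
      ∎
    where open ≈-Reasoning

  mulP-distribʳ : ∀ p q r → mulP (addP q r) p ≈ addP (mulP q p) (mulP r p)
  mulP-distribʳ p q r =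
    ≈-trans (mulP-comm (addP q r) p) (≈-trans (mulP-distribˡ p q r) (addP-cong (mulP-comm p q) (mulP-comm p r)))

  mulP-scaleˡ : ∀ c p q → mulP (scaleP c p) q ≈ scaleP c (mulP p q)
  mulP-scaleˡ c []      q = ≈-refl
  mulP-scaleˡ c (a ∷ p) q = begin
    addP (scaleP (c * a) q) (0ℚ ∷ mulP (scaleP c p) q)
      ≈⟨ addP-cong (scaleP-scaleP c a q) (∷-cong (sym (*-zeroʳ c)) (mulP-scaleˡ c p q)) ⟩
    addP (scaleP c (scaleP a q)) (scaleP c (0ℚ ∷ mulP p q))
      ≈⟨ ≈-sym (scaleP-addP c (scaleP a q) _) ⟩
    scaleP c (mulP (a ∷ p) q)
      ∎
    where open ≈-Reasoning

  mulP-assoc : ∀ p q r → mulP (mulP p q) r ≈ mulP p (mulP q r)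
  mulP-assoc []      q r = ≈-refl
  mulP-assoc (a ∷ p) q r = begin
    mulP (addP (scaleP a q) (0ℚ ∷ mulP p q)) r
      ≈⟨ mulP-distribʳ r (scaleP a q) _ ⟩
    addP (mulP (scaleP a q) r) (mulP (0ℚ ∷ mulP p q) r)
      ≈⟨ addP-cong (mulP-scaleˡ a q r) (≈-trans (mulP-0∷ (mulP p q) r) (∷-cong refl (mulP-assoc p q r))) ⟩
    mulP (a ∷ p) (mulP q r)
      ∎
    where open ≈-Reasoning

  mulP-identityˡ : ∀ p → mulP oneP p ≈ p
  mulP-identityˡ p = ≈-trans (addP-cong (scaleP-identity p) 0∷[]≈[]) (addP-identityʳ p)

  mulP-cong : ∀ {p p′ q q′} → p ≈ p′ → q ≈ q′ → mulP p q ≈ mulP p′ q′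
  mulP-cong {p} {p′} {q} {q′} p≈p′ q≈q′ =
    ≈-trans (mulP-comm p q) (≈-trans (mulP-congʳ q p≈p′) (≈-trans (mulP-comm q p′) (mulP-congʳ p′ q≈q′)))

  polyRing : CommutativeRing 0ℓ 0ℓ
  polyRing = record
    { Carrier = Poly ; _≈_ = _≈_ ; _+_ = addP ; _*_ = mulP ; -_ = negP ; 0# = [] ; 1# = oneP
    ; isCommutativeRing = record
      { isRing = record
        { +-isAbelianGroup = AbelianGroup.isAbelianGroup addP-abelianGroup
        ; *-cong = mulP-cong
        ; *-assoc = mulP-assoc
        ; *-identity = mulP-identityˡ , (λ p → ≈-trans (mulP-comm p oneP) (mulP-identityˡ p))
        ; distrib = mulP-distribˡ , mulP-distribʳ }
      ; *-comm = mulP-comm } }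

  -- The zero test lets the ring solver cancel opposite terms.
  []≟ : ∀ p → Maybe ([] ≈ p)
  []≟ []      = just ≈-refl
  []≟ (a ∷ p) with a ≟ 0ℚ | []≟ p
  ... | yes refl | just []≈p = just (≈-trans (≈-sym 0∷[]≈[]) (∷-cong refl []≈p))
  ... | _        | _         = nothing

  polyACR : ACR.AlmostCommutativeRing 0ℓ 0ℓ
  polyACR = ACR.fromCommutativeRing polyRing []≟

  shiftP : ℕ → Poly → Poly
  shiftP t p = replicate t 0ℚ ++ p

  shiftP-cong : ∀ t {p q} → p ≈ q → shiftP t p ≈ shiftP t q
  shiftP-cong zero    p≈q = p≈q
  shiftP-cong (suc t) p≈q = ∷-cong refl (shiftP-cong t p≈q)

  shiftP-[] : ∀ t → shiftP t [] ≈ []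
  shiftP-[] zero    = ≈-refl
  shiftP-[] (suc t) = ≈-trans (∷-cong refl (shiftP-[] t)) 0∷[]≈[]

  shiftP-addP : ∀ t p q → addP (shiftP t p) (shiftP t q) ≈ shiftP t (addP p q)
  shiftP-addP zero    p q = ≈-refl
  shiftP-addP (suc t) p q = ∷-cong (+-identityˡ 0ℚ) (shiftP-addP t p q)

  shiftP-scaleP : ∀ c t p → scaleP c (shiftP t p) ≈ shiftP t (scaleP c p)
  shiftP-scaleP c zero    p = ≈-refl
  shiftP-scaleP c (suc t) p = ∷-cong (*-zeroʳ c) (shiftP-scaleP c t p)

  mulP-shiftP : ∀ t p q → mulP (shiftP t p) q ≈ shiftP t (mulP p q)
  mulP-shiftP zero    p q = ≈-refl
  mulP-shiftP (suc t) p q = ≈-trans (mulP-0∷ (shiftP t p) q) (∷-cong refl (mulP-shiftP t p q))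

  module _ (m : ℕ) where

    substP-[] : ∀ {p} → p ≈ [] → substP m p ≈ []
    substP-[] {[]}    _    = ≈-refl
    substP-[] {a ∷ p} p≈[] with ∷-injective (≈-trans p≈[] (≈-sym 0∷[]≈[]))
    ... | a≡0 , p≈[]′ = ≈-trans (∷-cong a≡0 (≈-trans (shiftP-cong (m ∸ 1) (substP-[] p≈[]′)) (shiftP-[] (m ∸ 1)))) 0∷[]≈[]

    substP-cong : ∀ {p q} → p ≈ q → substP m p ≈ substP m q
    substP-cong {[]}    {q}     p≈q = ≈-sym (substP-[] (≈-sym p≈q))
    substP-cong {a ∷ p} {[]}    p≈q = substP-[] p≈q
    substP-cong {a ∷ p} {b ∷ q} p≈q with ∷-injective p≈q
    ... | a≡b , p≈q′ = ∷-cong a≡b (shiftP-cong (m ∸ 1) (substP-cong p≈q′))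

    substP-addP : ∀ p q → substP m (addP p q) ≈ addP (substP m p) (substP m q)
    substP-addP []      q       = ≈-refl
    substP-addP (a ∷ p) []      = ≈-sym (addP-identityʳ _)
    substP-addP (a ∷ p) (b ∷ q) =
      ∷-cong refl (≈-trans (shiftP-cong (m ∸ 1) (substP-addP p q)) (≈-sym (shiftP-addP (m ∸ 1) _ _)))

    substP-scaleP : ∀ c p → substP m (scaleP c p) ≈ scaleP c (substP m p)
    substP-scaleP c []      = ≈-refl
    substP-scaleP c (a ∷ p) =
      ∷-cong refl (≈-trans (shiftP-cong (m ∸ 1) (substP-scaleP c p)) (≈-sym (shiftP-scaleP c (m ∸ 1) _)))

    substP-mulP : ∀ p q → substP m (mulP p q) ≈ mulP (substP m p) (substP m q)
    substP-mulP []      q = ≈-refl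
    substP-mulP (a ∷ p) q =
      ≈-trans (substP-addP (scaleP a q) (0ℚ ∷ mulP p q))
        (addP-cong (substP-scaleP a q)
          (∷-cong refl (≈-trans (shiftP-cong (m ∸ 1) (substP-mulP p q)) (≈-sym (mulP-shiftP (m ∸ 1) _ _)))))

    substP-oneP : substP m oneP ≈ oneP
    substP-oneP = ∷-cong refl (shiftP-[] (m ∸ 1))

  private
    *-zero-cancelʳ : ∀ {a b} → a ≢ 0ℚ → b * a ≡ 0ℚ → b ≡ 0ℚ
    *-zero-cancelʳ {a} {b} a≢0 ba≡0 = begin
      b                ≡⟨ sym (*-identityʳ b) ⟩
      b * 1ℚ           ≡⟨ cong (b *_) (sym (*-inverseʳ a)) ⟩
      b * (a * 1/ a)   ≡⟨ sym (*-assoc b a (1/ a)) ⟩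
      b * a * 1/ a     ≡⟨ cong (_* 1/ a) ba≡0 ⟩
      0ℚ * 1/ a        ≡⟨ *-zeroˡ (1/ a) ⟩
      0ℚ               ∎
      where
      open ≡-Reasoning
      instance _ = ≢-nonZero a≢0

  mulP-∷-noZeroDivisor : ∀ {a} c z → a ≢ 0ℚ → mulP (a ∷ c) z ≈ [] → z ≈ []
  mulP-∷-noZeroDivisor     c []      a≢0 _       = ≈-refl
  mulP-∷-noZeroDivisor {a} c (b ∷ z) a≢0 acbz≈[]
    with ∷-injective (≈-trans (≈-sym (mulP-∷ʳ (a ∷ c) b z)) (≈-trans acbz≈[] (≈-sym 0∷[]≈[])))
  ... | ba+0≡0 , rest≈[] = ≈-trans (∷-cong b≡0 (mulP-∷-noZeroDivisor c z a≢0 acz≈[])) 0∷[]≈[]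
    where
    b≡0 : b ≡ 0ℚ
    b≡0 = *-zero-cancelʳ a≢0 (trans (sym (+-identityʳ (b * a))) ba+0≡0)
    bc≈[] : scaleP b c ≈ []
    bc≈[] = coeffwise λ n → trans (coeff-scaleP b c n) (trans (cong (_* coeff c n) b≡0) (*-zeroˡ (coeff c n)))
    acz≈[] : mulP (a ∷ c) z ≈ []
    acz≈[] = ≈-trans (addP-cong (≈-sym bc≈[]) ≈-refl) rest≈[]

  mulP-noZeroDivisor : ∀ c z → ¬ c ≈ [] → mulP c z ≈ [] → z ≈ []
  mulP-noZeroDivisor []      z c≉[] _ = ⊥-elim (c≉[] ≈-refl)
  mulP-noZeroDivisor (a ∷ c) z c≉[] acz≈[] with a ≟ 0ℚ
  ... | no  a≢0  = mulP-∷-noZeroDivisor c z a≢0 acz≈[]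
  ... | yes refl = mulP-noZeroDivisor c z (λ c≈[] → c≉[] (≈-trans (∷-cong refl c≈[]) 0∷[]≈[]))
                     (proj₂ (∷-injective (≈-trans (≈-sym (mulP-0∷ c z)) (≈-trans acz≈[] (≈-sym 0∷[]≈[])))))

  mulP-≉[] : ∀ {p q} → ¬ p ≈ [] → ¬ q ≈ [] → ¬ mulP p q ≈ []
  mulP-≉[] {p} {q} p≉[] q≉[] pq≈[] = q≉[] (mulP-noZeroDivisor p q p≉[] pq≈[])

  mulP-cancelˡ : ∀ {c x y} → ¬ c ≈ [] → mulP c x ≈ mulP c y → x ≈ y
  mulP-cancelˡ {c} {x} {y} c≉[] cx≈cy =
    x∙y⁻¹≈ε⇒x≈y x y (mulP-noZeroDivisor c _ c≉[] (≈-trans (x[y-z]≈xy-xz c x y) (x≈y⇒x∙y⁻¹≈ε cx≈cy)))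
    where
    open import Algebra.Properties.Ring (CommutativeRing.ring polyRing) using (x[y-z]≈xy-xz)
    open import Algebra.Properties.Group (AbelianGroup.group addP-abelianGroup) using (x∙y⁻¹≈ε⇒x≈y; x≈y⇒x∙y⁻¹≈ε)

  oneP-≉[] : ¬ oneP ≈ []
  oneP-≉[] oneP≈[] = 1≢0 (at oneP≈[] 0)

  open CommutativeRingProperties polyRing

  -- Euclidean division and Bézout identities

  DegreeBelow : Poly → ℕ → Set
  DegreeBelow p n = ∀ m → n ≤ m → coeff p m ≡ 0ℚ

  degreeBelow-length : ∀ p → DegreeBelow p (length p)
  degreeBelow-length []      m       _         = refl
  degreeBelow-length (a ∷ p) (suc m) (s≤s l≤m) = degreeBelow-length p m l≤m

  degreeBelow-mono : ∀ {p m n} → m ≤ n → DegreeBelow p m → DegreeBelow p n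
  degreeBelow-mono m≤n p<m k n≤k = p<m k (≤-trans m≤n n≤k)

  zero-or-degree : ∀ n p → DegreeBelow p n → p ≈ [] ⊎ ∃ λ d → d < n × coeff p d ≢ 0ℚ × DegreeBelow p (suc d)
  zero-or-degree zero    p p<0 = inj₁ (coeffwise λ m → p<0 m z≤n)
  zero-or-degree (suc n) p p<n+1 with coeff p n ≟ 0ℚ
  ... | no  pₙ≢0 = inj₂ (n , ≤-refl , pₙ≢0 , p<n+1)
  ... | yes pₙ≡0 with zero-or-degree n p p<n
    where
    p<n : DegreeBelow p n
    p<n m n≤m with Nat.m≤n⇒m<n∨m≡n n≤m
    ... | inj₁ n<m  = p<n+1 m n<m
    ... | inj₂ refl = pₙ≡0
  ...   | inj₁ p≈[]                  = inj₁ p≈[]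
  ...   | inj₂ (d , d<n , lead , p<d+1) = inj₂ (d , Nat.m<n⇒m<1+n d<n , lead , p<d+1)

  coeff-shiftP : ∀ t p j → coeff (shiftP t p) (t Nat.+ j) ≡ coeff p j
  coeff-shiftP zero    p j = refl
  coeff-shiftP (suc t) p j = coeff-shiftP t p j

  record Division (f g : Poly) (d : ℕ) : Set where
    field
      quotient remainder : Poly
      division  : f ≈ addP (mulP quotient g) remainder
      remainder<d : DegreeBelow remainder d

  module _ {g d} (lead : coeff g d ≢ 0ℚ) (g<d+1 : DegreeBelow g (suc d)) where

    -- Subtracting c x^t g, with c the ratio of leading coefficients, lowers the bound t + 1 + d to t + d.

    divide : ∀ t f → DegreeBelow f (t Nat.+ d) → Division f g d
    divide zero    f f<d = record { quotient = [] ; remainder = f ; division = ≈-refl ; remainder<d = f<d }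
    divide (suc t) f f<t+d+1 = record
      { quotient = addP (Division.quotient rec) (shiftP t (c ∷ []))
      ; remainder = Division.remainder rec
      ; division = ≈-trans (≈-sym (sub-add f M))
                     (≈-trans (addP-cong (Division.division rec) ≈-refl)
                       (regroup (Division.quotient rec) g (Division.remainder rec) (shiftP t (c ∷ []))))
      ; remainder<d = Division.remainder<d rec }
      where
      instance _ = ≢-nonZero lead
      c : ℚ
      c = coeff f (t Nat.+ d) * 1/ coeff g d
      M : Poly
      M = mulP (shiftP t (c ∷ [])) g
      coeff-M : ∀ j → coeff M (t Nat.+ j) ≡ c * coeff g j
      coeff-M j = trans (at (≈-trans (mulP-shiftP t (c ∷ []) g) (shiftP-cong t c·g≈)) (t Nat.+ j))
                        (trans (coeff-shiftP t (scaleP c g) j) (coeff-scaleP c g j))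
        where
        c·g≈ : mulP (c ∷ []) g ≈ scaleP c g
        c·g≈ = ≈-trans (addP-cong ≈-refl 0∷[]≈[]) (addP-identityʳ (scaleP c g))
      f≡M : ∀ j → d ≤ j → coeff f (t Nat.+ j) ≡ coeff M (t Nat.+ j)
      f≡M j d≤j with Nat.m≤n⇒m<n∨m≡n d≤j
      ... | inj₂ refl = sym (trans (coeff-M d) (begin
        c * coeff g d                                  ≡⟨ *-assoc (coeff f (t Nat.+ d)) _ _ ⟩
        coeff f (t Nat.+ d) * (1/ coeff g d * coeff g d) ≡⟨ cong (coeff f (t Nat.+ d) *_) (*-inverseˡ (coeff g d)) ⟩
        coeff f (t Nat.+ d) * 1ℚ                       ≡⟨ *-identityʳ _ ⟩
        coeff f (t Nat.+ d)                            ∎))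
        where open ≡-Reasoning
      ... | inj₁ d<j = trans (f<t+d+1 (t Nat.+ j) (subst (_≤ t Nat.+ j) (Nat.+-suc t d) (Nat.+-monoʳ-≤ t d<j)))
                             (sym (trans (coeff-M j) (trans (cong (c *_) (g<d+1 j d<j)) (*-zeroʳ c))))
      f′ : Poly
      f′ = addP f (negP M)
      f′<t+d : DegreeBelow f′ (t Nat.+ d)
      f′<t+d m t+d≤m = begin
        coeff f′ m                                    ≡⟨ trans (coeff-addP f (negP M) m) (cong (coeff f m +_) (coeff-negP M m)) ⟩
        coeff f m + - coeff M m                       ≡⟨ cong (λ k → coeff f k + - coeff M k) (sym (m+[n∸m]≡n t≤m)) ⟩
        coeff f (t Nat.+ j) + - coeff M (t Nat.+ j)   ≡⟨ cong (_+ - coeff M (t Nat.+ j)) (f≡M j d≤j) ⟩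
        coeff M (t Nat.+ j) + - coeff M (t Nat.+ j)   ≡⟨ +-inverseʳ (coeff M (t Nat.+ j)) ⟩
        0ℚ                                            ∎
        where
        open ≡-Reasoning
        j = m ∸ t
        t≤m : t ≤ m
        t≤m = Nat.m+n≤o⇒m≤o t t+d≤m
        d≤j : d ≤ j
        d≤j = m+n≤o⇒m≤o∸n d (subst (_≤ m) (Nat.+-comm t d) t+d≤m)
      rec = divide t f′ f′<t+d
      sub-add : ∀ f M → addP (addP f (negP M)) M ≈ f
      sub-add = solve-∀ polyACR
      regroup : ∀ q g r m → addP (addP (mulP q g) r) (mulP m g) ≈ addP (mulP (addP q m) g) r
      regroup = solve-∀ polyACR

  record Bezout (f g : Poly) : Set where
    field
      gcd u v  : Poly
      gcd∣f    : gcd ∣ f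
      gcd∣g    : gcd ∣ g
      identity : addP (mulP u f) (mulP v g) ≈ gcd

  bezout-[] : ∀ {f g} → g ≈ [] → Bezout f g
  bezout-[] {f} g≈[] = record
    { gcd = f ; u = oneP ; v = [] ; gcd∣f = ∣ʳ-refl ; gcd∣g = ∣ʳ-respʳ-≈ (≈-sym g≈[]) (f ∣0)
    ; identity = ≈-trans (addP-identityʳ (mulP oneP f)) (mulP-identityˡ f) }

  euclid : ∀ n f g → DegreeBelow g n → Bezout f g
  euclid zero    f g g<0 = bezout-[] (coeffwise λ m → g<0 m z≤n)
  euclid (suc n) f g g<n+1 with zero-or-degree (suc n) g g<n+1
  ... | inj₁ g≈[] = bezout-[] g≈[]
  ... | inj₂ (d , s≤s d≤n , lead , g<d+1) = record
    { gcd = gcd ; u = v ; v = addP u (negP (mulP v q))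
    ; gcd∣f = ∣ʳ-respʳ-≈ (≈-sym division) (∣-+ (x∣ʳy⇒x∣ʳzy q gcd∣f) gcd∣g)
    ; identity = ≈-trans (addP-cong (mulP-congʳ v division) ≈-refl) (≈-trans (regroup u v q g r) identity)
    ; gcd∣g = gcd∣f }
    where
    open Division (divide {g} lead g<d+1 (length f) f (degreeBelow-mono {f} (Nat.m≤m+n (length f) d) (degreeBelow-length f)))
      renaming (quotient to q; remainder to r)
    open Bezout (euclid n g r (degreeBelow-mono {r} d≤n remainder<d))
    regroup : ∀ u v q g r → addP (mulP v (addP (mulP q g) r)) (mulP (addP u (negP (mulP v q))) g)
                          ≈ addP (mulP u g) (mulP v r)
    regroup = solve-∀ polyACR

  bezout : ∀ f g → Bezout f g
  bezout f g = euclid (length g) f g (degreeBelow-length g)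

  ∣ₚ⇒∣ : ∀ {p q} → p ∣ₚ q → p ∣ q
  ∣ₚ⇒∣ (d , dp≈q) = d , coeffwise dp≈q

  ∣⇒∣ₚ : ∀ {p q} → p ∣ q → p ∣ₚ q
  ∣⇒∣ₚ (d , dp≈q) = d , at dp≈q

  coprime⇒bezout : ∀ a b → Coprime2 a b → ∃₂ λ u v → addP (mulP u a) (mulP v b) ≈ oneP
  coprime⇒bezout a b coprime =
    let h , h·gcd≈1 = ∣ₚ⇒∣ (coprime gcd (∣⇒∣ₚ gcd∣f) (∣⇒∣ₚ gcd∣g))
    in  mulP h u , mulP h v , ≈-trans (factor h u v a b) (≈-trans (mulP-congʳ h identity) h·gcd≈1)
    where
    open Bezout (bezout a b)
    factor : ∀ h u v a b → addP (mulP (mulP h u) a) (mulP (mulP h v) b) ≈ mulP h (addP (mulP u a) (mulP v b))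
    factor = solve-∀ polyACR

  familyGcd : ∀ n (q : ℕ → Poly) → Σ[ G ∈ Poly ] Σ[ w ∈ (ℕ → Poly) ] (∀ j → j < n → G ∣ q j) × ∑< n (λ j → mulP (w j) (q j)) ≈ G
  familyGcd zero    q = [] , (λ _ → []) , (λ j ()) , ≈-refl
  familyGcd (suc n) q with familyGcd n (q ∘ suc)
  ... | G , w , G∣q , ∑wq≈G = gcd , w′ , gcd∣q , ∑w′q≈gcd
    where
    open Bezout (bezout (q 0) G)
    w′ : ℕ → Poly
    w′ zero    = u
    w′ (suc j) = mulP v (w j)
    gcd∣q : ∀ j → j < suc n → gcd ∣ q j
    gcd∣q zero    _         = gcd∣f
    gcd∣q (suc j) (s<s j<n) = ∣ʳ-trans gcd∣g (G∣q j j<n)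
    ∑w′q≈gcd : addP (mulP u (q 0)) (∑< n (λ j → mulP (mulP v (w j)) (q (suc j)))) ≈ gcd
    ∑w′q≈gcd = ≈-trans (addP-cong ≈-refl (≈-trans (∑<-factorˡ n v w (q ∘ suc)) (mulP-congʳ v ∑wq≈G))) identity

  coprimeFamily⇒bezout : ∀ s q → CoprimeFamily s q → Σ[ w ∈ (ℕ → Poly) ] ∑< (suc s) (λ j → mulP (w j) (q j)) ≈ oneP
  coprimeFamily⇒bezout s q coprime with familyGcd (suc s) q
  ... | G , w , G∣q , ∑wq≈G with ∣ₚ⇒∣ (coprime G (λ j j≤s → ∣⇒∣ₚ (G∣q j (s≤s j≤s))))
  ... | h , hG≈1 = (λ j → mulP h (w j)) , ≈-trans (∑<-factorˡ (suc s) h w q) (≈-trans (mulP-congʳ h ∑wq≈G) hG≈1)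

open Polynomial
open import Relation.Binary.PropositionalEquality.Core using (refl; sym; trans)
open CommutativeRingProperties polyRing

-- Clearing denominators in the product R S

infix 4 _≃_/_

_≃_/_ : RatFun → Poly → Poly → Set
x ≃ V / Z = mulP (proj₁ x) Z ≈ mulP V (proj₂ x)

Den≉[] : RatFun → Set
Den≉[] x = ¬ proj₂ x ≈ []

rfAdd-≃ : ∀ {x y V W Z} → x ≃ V / Z → y ≃ W / Z → rfAdd x y ≃ addP V W / Z
rfAdd-≃ {n₁ , d₁} {n₂ , d₂} {V} {W} {Z} n₁Z≈Vd₁ n₂Z≈Wd₂ = begin
  mulP (addP (mulP n₁ d₂) (mulP n₂ d₁)) Z          ≈⟨ expand n₁ d₁ n₂ d₂ Z ⟩
  addP (mulP (mulP n₁ Z) d₂) (mulP (mulP n₂ Z) d₁) ≈⟨ addP-cong (mulP-cong n₁Z≈Vd₁ ≈-refl) (mulP-cong n₂Z≈Wd₂ ≈-refl) ⟩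
  addP (mulP (mulP V d₁) d₂) (mulP (mulP W d₂) d₁) ≈⟨ collect V d₁ W d₂ ⟩
  mulP (addP V W) (mulP d₁ d₂)                     ∎
  where
  open ≈-Reasoning
  expand : ∀ n₁ d₁ n₂ d₂ Z → mulP (addP (mulP n₁ d₂) (mulP n₂ d₁)) Z ≈ addP (mulP (mulP n₁ Z) d₂) (mulP (mulP n₂ Z) d₁)
  expand = solve-∀ polyACR
  collect : ∀ V d₁ W d₂ → addP (mulP (mulP V d₁) d₂) (mulP (mulP W d₂) d₁) ≈ mulP (addP V W) (mulP d₁ d₂)
  collect = solve-∀ polyACR

rfMul-≃ : ∀ {x y V W Z} → x ≃ V / Z → y ≃ W / oneP → rfMul x y ≃ mulP V W / Z
rfMul-≃ {n₁ , d₁} {n₂ , d₂} {V} {W} {Z} n₁Z≈Vd₁ n₂≈Wd₂ = begin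
  mulP (mulP n₁ n₂) Z                    ≈⟨ regroup n₁ n₂ Z ⟩
  mulP (mulP n₁ Z) (mulP n₂ oneP)        ≈⟨ mulP-cong n₁Z≈Vd₁ n₂≈Wd₂ ⟩
  mulP (mulP V d₁) (mulP W d₂)           ≈⟨ interchange V d₁ W d₂ ⟩
  mulP (mulP V W) (mulP d₁ d₂)           ∎
  where
  open ≈-Reasoning
  regroup : ∀ n₁ n₂ Z → mulP (mulP n₁ n₂) Z ≈ mulP (mulP n₁ Z) (mulP n₂ oneP)
  regroup = solve-∀ polyACR
  interchange : ∀ V d₁ W d₂ → mulP (mulP V d₁) (mulP W d₂) ≈ mulP (mulP V W) (mulP d₁ d₂)
  interchange = solve-∀ polyACR

rfSubst-≃ : ∀ m {x W} → x ≃ W / oneP → rfSubst m x ≃ substP m W / oneP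
rfSubst-≃ m {n , d} {W} n≈Wd = begin
  mulP (substP m n) oneP             ≈⟨ mulP-congʳ (substP m n) (substP-oneP m) ⟨
  mulP (substP m n) (substP m oneP)  ≈⟨ substP-mulP m n oneP ⟨
  substP m (mulP n oneP)             ≈⟨ substP-cong m n≈Wd ⟩
  substP m (mulP W d)                ≈⟨ substP-mulP m W d ⟩
  mulP (substP m W) (substP m d)     ∎
  where open ≈-Reasoning

foldr-rfAdd-≃ : ∀ n (h : ℕ → RatFun) g {V : ℕ → Poly} {Z} → (∀ i → i < n → h (g i) ≃ V i / Z) →
                foldr rfAdd rf0 (map h (applyUpTo g n)) ≃ ∑< n V / Z
foldr-rfAdd-≃ zero    h g hᵢ≃ = ≈-refl
foldr-rfAdd-≃ (suc n) h g {V} {Z} hᵢ≃ =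
  rfAdd-≃ {h (g 0)} {foldr rfAdd rf0 (map h (applyUpTo (g ∘ suc) n))} {V 0} {∑< n (V ∘ suc)} {Z}
          (hᵢ≃ 0 z<s) (foldr-rfAdd-≃ n h (g ∘ suc) (λ i i<n → hᵢ≃ (suc i) (s<s i<n)))

foldr-rfAdd-Den≉[] : ∀ n (h : ℕ → RatFun) g → (∀ i → i < n → Den≉[] (h (g i))) →
                     Den≉[] (foldr rfAdd rf0 (map h (applyUpTo g n)))
foldr-rfAdd-Den≉[] zero    h g _      = oneP-≉[]
foldr-rfAdd-Den≉[] (suc n) h g hᵢ≉[] =
  mulP-≉[] (hᵢ≉[] 0 z<s) (foldr-rfAdd-Den≉[] n h (g ∘ suc) (λ i i<n → hᵢ≉[] (suc i) (s<s i<n)))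

isPoly-≃⇒∣ : ∀ {x V Z} → IsPolyRF x → Den≉[] x → x ≃ V / Z → Z ∣ V
isPoly-≃⇒∣ {n , d} {V} {Z} (P , n≈Pd) d≉[] nZ≈Vd = P , mulP-cancelˡ {d} d≉[] (begin
  mulP d (mulP P Z)   ≈⟨ regroup d P Z ⟩
  mulP (mulP P d) Z   ≈⟨ mulP-cong (coeffwise {n} {mulP P d} n≈Pd) ≈-refl ⟨
  mulP n Z            ≈⟨ nZ≈Vd ⟩
  mulP V d            ≈⟨ mulP-comm V d ⟩
  mulP d V            ∎)
  where
  open ≈-Reasoning
  regroup : ∀ d P Z → mulP d (mulP P Z) ≈ mulP (mulP P d) Z
  regroup = solve-∀ polyACR

coeffAt-map-applyUpTo : ∀ (f : ℕ → RatFun) g n {i} → i < n → coeffAt (map f (applyUpTo g n)) i ≡ f (g i)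
coeffAt-map-applyUpTo f g (suc n) {zero}  _         = refl
coeffAt-map-applyUpTo f g (suc n) {suc i} (s<s i<n) = coeffAt-map-applyUpTo f (g ∘ suc) n i<n

coeffAt-map-applyUpTo-beyond : ∀ (f : ℕ → RatFun) g n {i} → n ≤ i → coeffAt (map f (applyUpTo g n)) i ≡ rf0
coeffAt-map-applyUpTo-beyond f g zero    _         = refl
coeffAt-map-applyUpTo-beyond f g (suc n) (s≤s n≤i) = coeffAt-map-applyUpTo-beyond f (g ∘ suc) n n≤i

AllL-map-applyUpTo : ∀ {P : RatFun → Set} (f : ℕ → RatFun) g n {i} →
                     AllL P (map f (applyUpTo g n)) → i < n → P (f (g i))
AllL-map-applyUpTo f g (suc n) {zero}  (all∷ p _)  _         = p
AllL-map-applyUpTo f g (suc n) {suc i} (all∷ _ ps) (s<s i<n) = AllL-map-applyUpTo f (g ∘ suc) n ps i<n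

length-map-upTo : ∀ (f : ℕ → RatFun) n → length (map f (upTo n)) ≡ n
length-map-upTo f n = trans (length-map f (upTo n)) (length-upTo n)

prodP-map-applyUpTo : ∀ (f : ℕ → Poly) g n → prodP (map f (applyUpTo g n)) ≡ ∏< n (f ∘ g)
prodP-map-applyUpTo f g zero    = refl
prodP-map-applyUpTo f g (suc n) = cong (mulP (f (g 0))) (prodP-map-applyUpTo f (g ∘ suc) n)

∏<-≉[] : ∀ n {f} → (∀ i → i < n → ¬ f i ≈ []) → ¬ ∏< n f ≈ []
∏<-≉[] zero    _      = oneP-≉[]
∏<-≉[] (suc n) fᵢ≉[] = mulP-≉[] (fᵢ≉[] 0 z<s) (∏<-≉[] n (λ i i<n → fᵢ≉[] (suc i) (s<s i<n)))

mulP-∣-cancelˡ : ∀ {c x y} → ¬ c ≈ [] → mulP c x ∣ mulP c y → x ∣ y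
mulP-∣-cancelˡ {c} {x} {y} c≉[] (p , p·cx≈cy) = p , mulP-cancelˡ c≉[] (≈-trans (regroup c p x) p·cx≈cy)
  where
  regroup : ∀ c p x → mulP c (mulP p x) ≈ mulP p (mulP c x)
  regroup = solve-∀ polyACR

-- α and β are read off through coeffAt, whose value rf0 = 0 / 1 beyond the last coefficient makes them vanish there.
module ClearingDenominators (k s r : ℕ) (q a b : ℕ → Poly) (b≉[] : ∀ i → i ≤ r → ¬ b i ≈ []) where

  L M : ROp
  L = ratOp r a b
  M = polyOp s q

  B : Poly
  B = ∏< (suc r) b

  α : ℕ → Poly
  α i = mulP (proj₁ (coeffAt L i)) (cofactor (suc r) b i)

  β : ℕ → ℕ → Poly
  β i j = substP (k ^ i) (proj₁ (coeffAt M j))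

  open Elimination B α β public

  ratOp-coeff : ∀ {i} → i ≤ r → coeffAt L i ≡ (a i , b i)
  ratOp-coeff i≤r = coeffAt-map-applyUpTo _ (λ i → i) (suc r) (s≤s i≤r)

  polyOp-coeff : ∀ {j} → j ≤ s → coeffAt M j ≡ (q j , oneP)
  polyOp-coeff j≤s = coeffAt-map-applyUpTo _ (λ j → j) (suc s) (s≤s j≤s)

  polyOp-den : ∀ j → proj₂ (coeffAt M j) ≡ oneP
  polyOp-den j with j ≤? s
  ... | yes j≤s = cong proj₂ (polyOp-coeff j≤s)
  ... | no  j≰s = cong proj₂ (coeffAt-map-applyUpTo-beyond (λ i → (q i , oneP)) (λ j → j) (suc s) (≰⇒> j≰s))

  polyOp-≃ : ∀ j → coeffAt M j ≃ proj₁ (coeffAt M j) / oneP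
  polyOp-≃ j rewrite polyOp-den j = ≈-refl

  ratOp-≃ : ∀ i → coeffAt L i ≃ α i / B
  ratOp-≃ i with i ≤? r
  ... | yes i≤r rewrite ratOp-coeff i≤r = begin
    mulP (a i) B                                       ≈⟨ mulP-congʳ (a i) (*-cofactor (suc r) b (s≤s i≤r)) ⟨
    mulP (a i) (mulP (b i) (cofactor (suc r) b i))     ≈⟨ regroup (a i) (b i) _ ⟩
    mulP (mulP (a i) (cofactor (suc r) b i)) (b i)     ∎
    where
    open ≈-Reasoning
    regroup : ∀ a b c → mulP a (mulP b c) ≈ mulP (mulP a c) b
    regroup = solve-∀ polyACR
  ... | no  i≰r rewrite coeffAt-map-applyUpTo-beyond (λ i → (a i , b i)) (λ i → i) (suc r) (≰⇒> i≰r) = ≈-refl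

  ratOp-Den≉[] : ∀ i → Den≉[] (coeffAt L i)
  ratOp-Den≉[] i with i ≤? r
  ... | yes i≤r rewrite ratOp-coeff i≤r = b≉[] i i≤r
  ... | no  i≰r rewrite coeffAt-map-applyUpTo-beyond (λ i → (a i , b i)) (λ i → i) (suc r) (≰⇒> i≰r) = oneP-≉[]

  α-at : ∀ {i} → i ≤ r → α i ≡ mulP (a i) (cofactor (suc r) b i)
  α-at i≤r = cong (λ x → mulP (proj₁ x) _) (ratOp-coeff i≤r)

  β-at : ∀ i {j} → j ≤ s → β i j ≡ substP (k ^ i) (q j)
  β-at i j≤s = cong (λ x → substP (k ^ i) (proj₁ x)) (polyOp-coeff j≤s)

  α-beyond : ∀ i → r < i → α i ≈ []
  α-beyond i r<i rewrite coeffAt-map-applyUpTo-beyond (λ i → (a i , b i)) (λ i → i) (suc r) r<i = ≈-refl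

  B∣conv : AllL IsPolyRF (opMul k L M) → ∀ m → m ≤ r Nat.+ s → B ∣ conv m
  B∣conv isPoly m m≤r+s =
    isPoly-≃⇒∣ {foldr rfAdd rf0 (map term (upTo (suc m)))} (AllL-map-applyUpTo _ (λ m → m) _ isPoly m<len) den≉[] coeff≃
    where
    term : ℕ → RatFun
    term i = rfMul (coeffAt L i) (rfSubst (k ^ i) (coeffAt M (m ∸ i)))
    m<len : m < length L Nat.+ length M ∸ 1
    m<len = subst (m <_) (sym (trans length≡ (Nat.+-suc r s))) (s≤s m≤r+s)
      where
      length≡ : length L Nat.+ length M ∸ 1 ≡ r Nat.+ suc s
      length≡ = cong₂ (λ x y → x Nat.+ y ∸ 1) (length-map-upTo (λ i → (a i , b i)) (suc r))
                                             (length-map-upTo (λ j → (q j , oneP)) (suc s))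
    coeff≃ : foldr rfAdd rf0 (map term (upTo (suc m))) ≃ conv m / B
    coeff≃ = foldr-rfAdd-≃ (suc m) term (λ i → i) {λ i → mulP (α i) (β i (m ∸ i))} {B} λ i _ →
      rfMul-≃ {coeffAt L i} {rfSubst (k ^ i) (coeffAt M (m ∸ i))} {α i} {β i (m ∸ i)} {B} (ratOp-≃ i)
              (rfSubst-≃ (k ^ i) {coeffAt M (m ∸ i)} {proj₁ (coeffAt M (m ∸ i))} (polyOp-≃ (m ∸ i)))
    den≉[] : Den≉[] (foldr rfAdd rf0 (map term (upTo (suc m))))
    den≉[] = foldr-rfAdd-Den≉[] (suc m) term (λ i → i) (λ i _ →
      mulP-≉[] (ratOp-Den≉[] i) (λ σd≈[] → oneP-≉[] (≈-trans (≈-sym (substP-oneP (k ^ i)))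
                                   (subst (λ d → substP (k ^ i) d ≈ []) (polyOp-den (m ∸ i)) σd≈[]))))

  bᵣ∣aᵣσqQ : AllL IsPolyRF (opMul k L M) → ∀ j → j ≤ s → b r ∣ mulP (a r) (mulP (substP (k ^ r) (q j)) (Q r))
  bᵣ∣aᵣσqQ isPoly j j≤s = mulP-∣-cancelˡ C≉[]
    (∣ʳ-respˡ-≈ (≈-trans (≈-sym (*-cofactor (suc r) b (s≤s ≤-refl))) (mulP-comm (b r) C))
      (∣ʳ-respʳ-≈ (regroup (a r) C (substP (k ^ r) (q j)) (Q r)) B∣aCσqQ))
    where
    C : Poly
    C = cofactor (suc r) b r
    C≉[] : ¬ C ≈ []
    C≉[] = x∣y∧y≉0⇒x≉0 (b r , *-cofactor (suc r) b (s≤s ≤-refl))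
             (∏<-≉[] (suc r) {b} (λ i i<r+1 → b≉[] i (≤-pred i<r+1)))
    B∣aCσqQ : B ∣ mulP (mulP (mulP (a r) C) (substP (k ^ r) (q j))) (Q r)
    B∣aCσqQ = subst (λ x → B ∣ mulP x (Q r)) (cong₂ mulP (α-at ≤-refl) (β-at r j≤s))
                (∣-α*β*Q r s α-beyond (B∣conv isPoly) j j≤s)
    regroup : ∀ a C x Q → mulP (mulP (mulP a C) x) Q ≈ mulP C (mulP a (mulP x Q))
    regroup = solve-∀ polyACR

substP-∑< : ∀ m n f → substP m (∑< n f) ≈ ∑< n (λ i → substP m (f i))
substP-∑< m zero    f = ≈-refl
substP-∑< m (suc n) f = ≈-trans (substP-addP m (f 0) (∑< n (f ∘ suc))) (addP-cong ≈-refl (substP-∑< m n (f ∘ suc)))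

coprime⇒∣ : ∀ a b {x} → Coprime2 a b → b ∣ mulP a x → b ∣ x
coprime⇒∣ a b coprime b∣ax =
  let u , v , ua+vb≈1 = coprime⇒bezout a b coprime in bezout⇒∣ u v ua+vb≈1 b∣ax

coprimeFamily⇒∣ : ∀ m s q {d x} → CoprimeFamily s q → (∀ j → j ≤ s → d ∣ mulP (substP m (q j)) x) → d ∣ x
coprimeFamily⇒∣ m s q coprime d∣σqx with coprimeFamily⇒bezout s q coprime
... | w , ∑wq≈1 = ∑-bezout⇒∣ (suc s) {substP m ∘ w} {substP m ∘ q} σ∑wq≈1 (λ j j<s+1 → d∣σqx j (≤-pred j<s+1))
  where
  σ∑wq≈1 : ∑< (suc s) (λ j → mulP (substP m (w j)) (substP m (q j))) ≈ oneP
  σ∑wq≈1 = begin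
    ∑< (suc s) (λ j → mulP (substP m (w j)) (substP m (q j)))  ≈⟨ ∑<-cong (suc s) (λ j _ → substP-mulP m (w j) (q j)) ⟨
    ∑< (suc s) (λ j → substP m (mulP (w j) (q j)))             ≈⟨ substP-∑< m (suc s) (λ j → mulP (w j) (q j)) ⟨
    substP m (∑< (suc s) (λ j → mulP (w j) (q j)))             ≈⟨ substP-cong m ∑wq≈1 ⟩
    substP m oneP                                              ≈⟨ substP-oneP m ⟩
    oneP                                                       ∎
    where open ≈-Reasoning

open import Data.Nat.Base using (_+_)

lemma4p7 : (k : ℕ) → 2 ≤ k → (F : PS) → IsMahler k F →
           (s : ℕ) (q : ℕ → Poly) →
           CoprimeFamily s q →
           ¬ (mulP (q 0) (q s) ≈ₚ []) →
           Annihilates k (polyOp s q) F →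
           (∀ (L : ROp) (d : ℕ) → ValidOp L → NonZeroOp L → Annihilates k L F → HasDegree L d → s ≤ d) →
           (r : ℕ) (a b : ℕ → Poly) →
           (∀ i → i ≤ r → NonZeroP (b i)) →
           (∀ i → i ≤ r → Coprime2 (a i) (b i)) →
           AllL IsPolyRF (opMul k (ratOp r a b) (polyOp s q)) →
           Annihilates k (opMul k (ratOp r a b) (polyOp s q)) F →
           HasDegree (opMul k (ratOp r a b) (polyOp s q)) (s + r) →
           b r ∣ₚ prodP (map (λ i → substP (k ^ i) (q 0)) (upTo r))
lemma4p7 k _ _ _ s q coprime-q _ _ _ r a b b≉[] coprime-ab isPoly _ _ =
  ∣⇒∣ₚ (subst (b r ∣_) (sym (prodP-map-applyUpTo (λ i → substP (k ^ i) (q 0)) id r))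
    (coprimeFamily⇒∣ (k ^ r) s q coprime-q λ j j≤s →
      coprime⇒∣ (a r) (b r) (coprime-ab r ≤-refl) (bᵣ∣aᵣσqQ isPoly j j≤s)))
  where open ClearingDenominators k s r q a b (λ i i≤r bᵢ≈[] → b≉[] i i≤r (at bᵢ≈[]))
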